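{- (i) The rule $[\mathsf 4]$ is derivable for $\{[\mathsf t],[\mathsf 5],\mathsf{nec}\}$. (ii) The rule $[\mathsf 4]$ is derivable for $\{[\mathsf b],[\mathsf 5],\mathsf{nec}\}$. (iii) The rule $[\mathsf 5]$ is derivable for $\{[\mathsf b],[\mathsf 4],\mathsf{wk}\}$.
   Context: A nested sequent is a finite multiset of modal formulas and boxed sequents $[\Delta]$. A context $\Gamma\{\ \}$ is a sequent with one hole (not inside a formula), $\Gamma\{\Delta\}$ its filling; binary contexts $\Gamma\{\ \}\{\ \}$ have two ordered holes, and the depth of $\Gamma\{\ \}\{\emptyset\}$ is the number of boxes enclosing the first hole. Rules (premises / conclusion): $[\mathsf t]$: $\Gamma\{[\Delta]\}/\Gamma\{\Delta\}$; $[\mathsf b]$: $\Gamma\{[\Delta,[\Sigma]]\}/\Gamma\{[\Delta],\Sigma\}$; $[\mathsf 4]$: $\Gamma\{[\Delta],[\Sigma]\}/\Gamma\{[[\Delta],\Sigma]\}$; $[\mathsf 5]$: $\Gamma\{[\Delta]\}\{\emptyset\}/\Gamma\{\emptyset\}\{[\Delta]\}$ provided depth of $\Gamma\{\ \}\{\emptyset\}>0$; $\mathsf{nec}$: $\Gamma/[\Gamma]$; $\mathsf{wk}$: $\Gamma\{\emptyset\}/\Gamma\{\Delta\}$. A rule $\rho$ is derivable for a set of rules $\mathcal S$ if for each instance of $\rho$ there is a finite derivation in $\mathcal S$ with the same conclusion all of whose premises are premises of that instance. -}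

module Defs where

open import Data.Nat using (ℕ; zero; suc; _+_; _<_)
open import Data.List using (List; []; _∷_; _++_; [_])
open import Data.List.Membership.Propositional using (_∈_)
open import Data.List.Relation.Unary.All using (All)
open import Data.List.Relation.Binary.Permutation.Homogeneous using (Permutation)
open import Data.Product using (_×_)

-- Modal formulas (the rules considered are purely structural, so the
-- precise connectives are immaterial).
data Fm : Set where
  var  : ℕ → Fm
  ⊥'   : Fm
  _⇒_  : Fm → Fm → Fm
  □    : Fm → Fm

-- Nested sequents: lists of items, identified up to (nested) multiset
-- equivalence _≈_ below.
data Item : Set where
  fm : Fm → Item
  bx : List Item → Item

Seq : Set
Seq = List Item

data _∼_ : Item → Item → Set where
  fm∼ : ∀ {A} → fm A ∼ fm A
  bx∼ : ∀ {Γ Δ} → Permutation _∼_ Γ Δ → bx Γ ∼ bx Δ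

_≈_ : Seq → Seq → Set
Γ ≈ Δ = Permutation _∼_ Γ Δ

⟦_⟧ : Seq → Seq
⟦ Δ ⟧ = [ bx Δ ]

-- unary contexts Γ{ }: the hole is either at top level of Γ, or inside
-- one of its boxed sequents
data Ctx : Set where
  top : Seq → Ctx
  dn  : Seq → Ctx → Ctx

plug : Ctx → Seq → Seq
plug (top Γ) Δ  = Γ ++ Δ
plug (dn Γ C) Δ = Γ ++ ⟦ plug C Δ ⟧

depth : Ctx → ℕ
depth (top _)  = 0
depth (dn _ C) = suc (depth C)

-- binary contexts Γ{ }{ }: either the two holes separate at this level
-- (Γ , C₁{ } , C₂{ }), or both lie in the same box (Γ , [ D{ }{ } ])
data Ctx2 : Set where
  here  : Seq → Ctx → Ctx → Ctx2
  inbox : Seq → Ctx2 → Ctx2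

plug2 : Ctx2 → Seq → Seq → Seq
plug2 (here Γ C₁ C₂) X Y = Γ ++ plug C₁ X ++ plug C₂ Y
plug2 (inbox Γ D)    X Y = Γ ++ ⟦ plug2 D X Y ⟧

-- depth of Γ{ }{∅}: number of boxes enclosing the first hole
depth2 : Ctx2 → ℕ
depth2 (here _ C₁ _) = depth C₁
depth2 (inbox _ D)   = suc (depth2 D)

data Rule : Set where
  rt rb r4 r5 nec wk : Rule

data Instance : Rule → List Seq → Seq → Set where
  t-inst   : ∀ (C : Ctx) Δ →
             Instance rt [ plug C ⟦ Δ ⟧ ] (plug C Δ)
  b-inst   : ∀ (C : Ctx) Δ Σ →
             Instance rb [ plug C ⟦ Δ ++ ⟦ Σ ⟧ ⟧ ] (plug C (⟦ Δ ⟧ ++ Σ))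
  4-inst   : ∀ (C : Ctx) Δ Σ →
             Instance r4 [ plug C (⟦ Δ ⟧ ++ ⟦ Σ ⟧) ] (plug C ⟦ ⟦ Δ ⟧ ++ Σ ⟧)
  5-inst   : ∀ (D : Ctx2) Δ → 0 < depth2 D →
             Instance r5 [ plug2 D ⟦ Δ ⟧ [] ] (plug2 D [] ⟦ Δ ⟧)
  nec-inst : ∀ Γ →
             Instance nec [ Γ ] ⟦ Γ ⟧
  wk-inst  : ∀ (C : Ctx) Δ →
             Instance wk [ plug C [] ] (plug C Δ)

data Deriv (S : List Rule) (Hyp : Seq → Set) : Seq → Set where
  hyp  : ∀ {Γ} → Hyp Γ → Deriv S Hyp Γ
  step : ∀ {r ps Γ} → r ∈ S → Instance r ps Γ →
         All (Deriv S Hyp) ps → Deriv S Hyp Γ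
  conv : ∀ {Γ Γ'} → Γ ≈ Γ' → Deriv S Hyp Γ → Deriv S Hyp Γ'

Derivable : Rule → List Rule → Set
Derivable ρ S = ∀ ps Γ → Instance ρ ps Γ → Deriv S (_∈ ps) Γ

-- (i) Box the premise with nec; inside that box [Δ] lies below the top level,
-- so [5] may move it into the sibling box [Σ], and [t] removes the box again.
-- (ii) Below the top level [5] alone suffices. At top level, box Γ, [Δ], [Σ]
-- twice, move [Δ] into [Σ] by [5], and unbox [[Γ, [[Δ], Σ]]] by [b] twice.
-- (iii) [4] moves a box one level into a sibling box, and [wk], [4], [b] move it
-- one level out: [Ξ, [Δ]] / [Ξ, [Δ], []] / [Ξ, [[Δ]]] / [Ξ], [Δ]. So [Δ] can be
-- carried from the first hole up to the top level and down into the second hole.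
module Submission where

open import Defs
open import Data.List using (List; []; _∷_; _++_; [_])
open import Data.List.Properties using (++-assoc; ++-identityʳ)
open import Data.List.Relation.Unary.Any using (here; there)
open import Data.List.Relation.Unary.All using ([]; _∷_)
open import Data.List.Relation.Binary.Pointwise.Base using (Pointwise; []; _∷_)
open import Data.List.Relation.Binary.Permutation.Homogeneous using (refl; prep; swap; trans)
open import Data.List.Relation.Binary.Permutation.Propositional as ↭ using (_↭_)
open import Data.List.Relation.Binary.Permutation.Propositional.Properties using (++-comm; shifts)
open import Data.List.Membership.Propositional using (_∈_)
open import Data.Nat using (s≤s; z≤n; _<_)
open import Data.Product using (_×_; _,_)
open import Function using (_∘_)
open import Relation.Binary.PropositionalEquality as ≡ using (_≡_; cong; sym; subst)

mutual
  ∼-refl : ∀ i → i ∼ i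
  ∼-refl (fm A) = fm∼
  ∼-refl (bx Γ) = bx∼ (refl (Pointwise-∼-refl Γ))

  Pointwise-∼-refl : ∀ Γ → Pointwise _∼_ Γ Γ
  Pointwise-∼-refl []      = []
  Pointwise-∼-refl (i ∷ Γ) = ∼-refl i ∷ Pointwise-∼-refl Γ

≈-refl : ∀ {Γ} → Γ ≈ Γ
≈-refl {Γ} = refl (Pointwise-∼-refl Γ)

↭⇒≈ : ∀ {Γ Δ} → Γ ↭ Δ → Γ ≈ Δ
↭⇒≈ ↭.refl          = ≈-refl
↭⇒≈ (↭.prep i p)    = prep (∼-refl i) (↭⇒≈ p)
↭⇒≈ (↭.swap i j p)  = swap (∼-refl i) (∼-refl j) (↭⇒≈ p)
↭⇒≈ (↭.trans p q)   = trans (↭⇒≈ p) (↭⇒≈ q)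

++⁺ˡ-≈ : ∀ Γ {Δ Δ'} → Δ ≈ Δ' → (Γ ++ Δ) ≈ (Γ ++ Δ')
++⁺ˡ-≈ []      p = p
++⁺ˡ-≈ (i ∷ Γ) p = prep (∼-refl i) (++⁺ˡ-≈ Γ p)

plug-cong : ∀ C {Δ Δ'} → Δ ≈ Δ' → plug C Δ ≈ plug C Δ'
plug-cong (top Γ)  p = ++⁺ˡ-≈ Γ p
plug-cong (dn Γ C) p = ++⁺ˡ-≈ Γ (prep (bx∼ (plug-cong C p)) (refl []))

_++ᶜ_ : Seq → Ctx → Ctx
Γ ++ᶜ top Δ  = top (Γ ++ Δ)
Γ ++ᶜ dn Δ C = dn (Γ ++ Δ) C

plug-++ᶜ : ∀ Γ C Δ → plug (Γ ++ᶜ C) Δ ≡ Γ ++ plug C Δ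
plug-++ᶜ Γ (top Σ)  Δ = ++-assoc Γ Σ Δ
plug-++ᶜ Γ (dn Σ C) Δ = ++-assoc Γ Σ _

_∘ᶜ_ : Ctx → Ctx → Ctx
top Γ  ∘ᶜ C = Γ ++ᶜ C
dn Γ E ∘ᶜ C = dn Γ (E ∘ᶜ C)

plug-∘ᶜ : ∀ E C Δ → plug (E ∘ᶜ C) Δ ≡ plug E (plug C Δ)
plug-∘ᶜ (top Γ)  C Δ = plug-++ᶜ Γ C Δ
plug-∘ᶜ (dn Γ E) C Δ = cong (λ Σ → Γ ++ ⟦ Σ ⟧) (plug-∘ᶜ E C Δ)

infix 4 _⊢_⇝_
_⊢_⇝_ : List Rule → Seq → Seq → Set₁
S ⊢ Γ ⇝ Δ = ∀ {H} E → Deriv S H (plug E Γ) → Deriv S H (plug E Δ)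

module _ {S : List Rule} where

  infixr 5 _⨾_
  _⨾_ : ∀ {Γ Δ Σ} → S ⊢ Γ ⇝ Δ → S ⊢ Δ ⇝ Σ → S ⊢ Γ ⇝ Σ
  (f ⨾ g) E = g E ∘ f E

  ⇝-run : ∀ {H Γ Δ} → S ⊢ Γ ⇝ Δ → Deriv S H Γ → Deriv S H Δ
  ⇝-run f = f (top [])

  ≡⇒⇝ : ∀ {Γ Δ} → Γ ≡ Δ → S ⊢ Γ ⇝ Δ
  ≡⇒⇝ e E = subst (Deriv S _ ∘ plug E) e

  ↭⇒⇝ : ∀ {Γ Δ} → Γ ↭ Δ → S ⊢ Γ ⇝ Δ
  ↭⇒⇝ p E = conv (plug-cong E (↭⇒≈ p))

  ⇝-plug : ∀ C {Γ Δ} → S ⊢ Γ ⇝ Δ → S ⊢ plug C Γ ⇝ plug C Δ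
  ⇝-plug C f E = subst (Deriv S _) (plug-∘ᶜ E C _)
               ∘ f (E ∘ᶜ C)
               ∘ subst (Deriv S _) (sym (plug-∘ᶜ E C _))

  ⇝-++ʳ : ∀ Σ {Γ Δ} → S ⊢ Γ ⇝ Δ → S ⊢ Γ ++ Σ ⇝ Δ ++ Σ
  ⇝-++ʳ Σ {Γ} {Δ} f = ↭⇒⇝ (++-comm Γ Σ) ⨾ ⇝-plug (top Σ) f ⨾ ↭⇒⇝ (++-comm Σ Δ)

  ⇝-box : ∀ {Γ Δ} → S ⊢ Γ ⇝ Δ → S ⊢ ⟦ Γ ⟧ ⇝ ⟦ Δ ⟧
  ⇝-box = ⇝-plug (dn [] (top []))

  t⇝ : rt ∈ S → ∀ Δ → S ⊢ ⟦ Δ ⟧ ⇝ Δ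
  t⇝ m Δ E d = step m (t-inst E Δ) (d ∷ [])

  b⇝ : rb ∈ S → ∀ Δ Σ → S ⊢ ⟦ Δ ++ ⟦ Σ ⟧ ⟧ ⇝ ⟦ Δ ⟧ ++ Σ
  b⇝ m Δ Σ E d = step m (b-inst E Δ Σ) (d ∷ [])

  4⇝ : r4 ∈ S → ∀ Δ Σ → S ⊢ ⟦ Δ ⟧ ++ ⟦ Σ ⟧ ⇝ ⟦ ⟦ Δ ⟧ ++ Σ ⟧
  4⇝ m Δ Σ E d = step m (4-inst E Δ Σ) (d ∷ [])

  wk⇝ : wk ∈ S → ∀ Δ → S ⊢ [] ⇝ Δ
  wk⇝ m Δ E d = step m (wk-inst E Δ) (d ∷ [])

  nec-run : ∀ {H Γ} → nec ∈ S → Deriv S H Γ → Deriv S H ⟦ Γ ⟧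
  nec-run m d = step m (nec-inst _) (d ∷ [])

beside-box : Ctx → Seq → Ctx2
beside-box (top Γ)  Σ = here Γ (top []) (dn [] (top Σ))
beside-box (dn Γ C) Σ = inbox Γ (beside-box C Σ)

plug2-beside-box : ∀ C Σ Γ Δ → plug2 (beside-box C Σ) Γ Δ ≡ plug C (Γ ++ ⟦ Σ ++ Δ ⟧)
plug2-beside-box (top _)  Σ Γ Δ = ≡.refl
plug2-beside-box (dn Π C) Σ Γ Δ = cong (λ X → Π ++ ⟦ X ⟧) (plug2-beside-box C Σ Γ Δ)

4-under-box-from-5 : ∀ {S H} → r5 ∈ S → ∀ C → 0 < depth C → ∀ Δ Σ →
  Deriv S H (plug C (⟦ Δ ⟧ ++ ⟦ Σ ⟧)) → Deriv S H (plug C ⟦ ⟦ Δ ⟧ ++ Σ ⟧)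
4-under-box-from-5 {S} {H} m C@(dn _ _) _ Δ Σ d =
  conv (plug-cong C (prep (bx∼ (↭⇒≈ (++-comm Σ ⟦ Δ ⟧))) (refl [])))
    (subst (Deriv S H) (plug2-beside-box C Σ [] ⟦ Δ ⟧)
      (step m (5-inst (beside-box C Σ) Δ (s≤s z≤n))
        (subst (Deriv S H) (sym (plug2-beside-box C Σ ⟦ Δ ⟧ [])) d′ ∷ [])))
  where
  d′ : Deriv S H (plug C (⟦ Δ ⟧ ++ ⟦ Σ ++ [] ⟧))
  d′ = subst (λ X → Deriv S H (plug C (⟦ Δ ⟧ ++ ⟦ X ⟧))) (sym (++-identityʳ Σ)) d

module FiveFromB4Wk {S : List Rule} (b∈ : rb ∈ S) (4∈ : r4 ∈ S) (wk∈ : wk ∈ S) (Δ : Seq) where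

  pull-out : ∀ Ξ → S ⊢ ⟦ Ξ ++ ⟦ Δ ⟧ ⟧ ⇝ ⟦ Ξ ⟧ ++ ⟦ Δ ⟧
  pull-out Ξ =
       ≡⇒⇝ (cong ⟦_⟧ (sym (++-identityʳ (Ξ ++ ⟦ Δ ⟧))))
    ⨾ ⇝-plug (dn [] (top (Ξ ++ ⟦ Δ ⟧))) (wk⇝ wk∈ ⟦ [] ⟧)
    ⨾ ≡⇒⇝ (cong ⟦_⟧ (++-assoc Ξ ⟦ Δ ⟧ ⟦ [] ⟧))
    ⨾ ⇝-plug (dn [] (top Ξ)) (4⇝ 4∈ Δ [])
    ⨾ b⇝ b∈ Ξ ⟦ Δ ⟧

  move-up : ∀ C → S ⊢ plug C ⟦ Δ ⟧ ⇝ plug C [] ++ ⟦ Δ ⟧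
  move-up (top Γ)  = ≡⇒⇝ (cong (_++ ⟦ Δ ⟧) (sym (++-identityʳ Γ)))
  move-up (dn Γ C) =
       ⇝-plug (dn Γ (top [])) (move-up C)
    ⨾ ⇝-plug (top Γ) (pull-out (plug C []))
    ⨾ ≡⇒⇝ (sym (++-assoc Γ ⟦ plug C [] ⟧ ⟦ Δ ⟧))

  move-down : ∀ C → S ⊢ ⟦ Δ ⟧ ++ plug C [] ⇝ plug C ⟦ Δ ⟧
  move-down (top Γ)  = ↭⇒⇝ (↭.trans (++-comm ⟦ Δ ⟧ (Γ ++ [])) (↭.↭-reflexive (cong (_++ ⟦ Δ ⟧) (++-identityʳ Γ))))
  move-down (dn Γ C) =
       ↭⇒⇝ (shifts ⟦ Δ ⟧ Γ)
    ⨾ ⇝-plug (top Γ) (4⇝ 4∈ Δ (plug C []))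
    ⨾ ⇝-plug (dn Γ (top [])) (move-down C)

  5⇝ : ∀ D → S ⊢ plug2 D ⟦ Δ ⟧ [] ⇝ plug2 D [] ⟦ Δ ⟧
  5⇝ (inbox Γ D)    = ⇝-plug (dn Γ (top [])) (5⇝ D)
  5⇝ (here Γ C₁ C₂) =
    ⇝-plug (top Γ)
      (  ⇝-++ʳ (plug C₂ []) (move-up C₁)
       ⨾ ≡⇒⇝ (++-assoc (plug C₁ []) ⟦ Δ ⟧ (plug C₂ []))
       ⨾ ⇝-plug (top (plug C₁ [])) (move-down C₂))

premise : ∀ {S P} → Deriv S (_∈ [ P ]) P
premise = hyp (here ≡.refl)

4-from-t5nec : Derivable r4 (rt ∷ r5 ∷ nec ∷ [])
4-from-t5nec _ _ (4-inst C Δ Σ) =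
  ⇝-run (t⇝ (here ≡.refl) _)
    (4-under-box-from-5 (there (here ≡.refl)) (dn [] C) (s≤s z≤n) Δ Σ
      (nec-run (there (there (here ≡.refl))) premise))

4-from-b5nec : Derivable r4 (rb ∷ r5 ∷ nec ∷ [])
4-from-b5nec _ _ (4-inst C@(dn _ _) Δ Σ) =
  4-under-box-from-5 (there (here ≡.refl)) C (s≤s z≤n) Δ Σ premise
4-from-b5nec _ _ (4-inst (top Γ) Δ Σ) =
  ⇝-run (  ⇝-box (b⇝ b∈ Γ (⟦ Δ ⟧ ++ Σ))
         ⨾ ⇝-box (↭⇒⇝ (++-comm ⟦ Γ ⟧ (⟦ Δ ⟧ ++ Σ)))
         ⨾ b⇝ b∈ (⟦ Δ ⟧ ++ Σ) Γ
         ⨾ ↭⇒⇝ (++-comm ⟦ ⟦ Δ ⟧ ++ Σ ⟧ Γ))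
    (4-under-box-from-5 (there (here ≡.refl)) (dn [] (dn [] (top Γ))) (s≤s z≤n) Δ Σ
      (nec-run nec∈ (nec-run nec∈ premise)))
  where
  b∈ : rb ∈ rb ∷ r5 ∷ nec ∷ []
  b∈ = here ≡.refl
  nec∈ : nec ∈ rb ∷ r5 ∷ nec ∷ []
  nec∈ = there (there (here ≡.refl))

5-from-b4wk : Derivable r5 (rb ∷ r4 ∷ wk ∷ [])
5-from-b4wk _ _ (5-inst D Δ _) =
  ⇝-run (FiveFromB4Wk.5⇝ (here ≡.refl) (there (here ≡.refl)) (there (there (here ≡.refl))) Δ D) premise

lemma2p48 : Derivable r4 (rt ∷ r5 ∷ nec ∷ [])
    × Derivable r4 (rb ∷ r5 ∷ nec ∷ [])
    × Derivable r5 (rb ∷ r4 ∷ wk ∷ [])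
lemma2p48 = 4-from-t5nec , 4-from-b5nec , 5-from-b4wk
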